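{- Every equivariant function between single-orbit sets with the integer atoms is semilinear.
   Context: Integer atoms: the atoms are $\mathbb{Z}$ with the successor function; the automorphisms are exactly the translations $x\mapsto x+z$, acting hereditarily on sets built from atoms. A set or function is equivariant if invariant under all translations ($f(x\cdot\pi)=f(x)\cdot\pi$); single-orbit sets are equivariant sets forming one orbit. For $k\ge1$, $\mathbb{Z}_k$ is the integers modulo $k$ with translations acting by addition, $\mathbb{Z}_0=\mathbb{Z}$; every equivariant single-orbit set is equivariantly isomorphic to some $\mathbb{Z}_k$. A subset of $\mathbb{Z}^m$ is semilinear if Presburger-definable; every subset of $\mathbb{Z}_k$ ($k\ge1$) is semilinear; a subset of a product $X_1\times\cdots\times X_n$ of single-orbit sets is semilinear if, after transport along equivariant isomorphisms $X_i\to\mathbb{Z}_{k_i}$ and the standard equivariant isomorphism of $\mathbb{Z}_{k_1}\times\cdots\times\mathbb{Z}_{k_n}$ with a disjoint union of monomials $\mathbb{Z}^m$, $\mathbb{Z}_k$ (via $\mathbb{Z}_k\times\mathbb{Z}\cong k$ copies of $\mathbb{Z}$, $\mathbb{Z}_k\times\mathbb{Z}_l\cong\mathbb{Z}_{\mathrm{lcm}(k,l)}$), it is semilinear on each component. A function is semilinear if its graph is. -}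

module Defs where

open import Data.Nat as ℕ using (ℕ; zero; suc)
open import Data.Nat.GCD using (gcd)
open import Data.Integer as ℤ using (ℤ; +_; _%ℕ_)
open import Data.Integer.DivMod using (n%ℕd<d)
open import Data.Fin as Fin using (Fin; fromℕ<)
open import Data.Product using (Σ; _×_; _,_)
open import Data.Sum using (_⊎_)
open import Data.Empty using (⊥)
open import Data.Unit using (⊤)
open import Relation.Binary.PropositionalEquality using (_≡_)
open import Function.Bundles using (_⇔_)

-- The single-orbit sets ℤ_k (ℤ_0 = ℤ, ℤ_k = integers modulo k for k ≥ 1)

Zk : ℕ → Set
Zk zero    = ℤ
Zk (suc n) = Fin (suc n)

proj : (k : ℕ) → ℤ → Zk k
proj zero    t = t
proj (suc n) t = fromℕ< (n%ℕd<d t (suc n))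

rep : (k : ℕ) → Zk k → ℤ
rep zero    x = x
rep (suc n) i = + (Fin.toℕ i)

act : (k : ℕ) → Zk k → ℤ → Zk k
act k x z = proj k (rep k x ℤ.+ z)

Equivariant : (k l : ℕ) → (Zk k → Zk l) → Set
Equivariant k l f = ∀ (x : Zk k) (z : ℤ) → f (act k x z) ≡ act l (f x) z

data Term (n : ℕ) : Set where
  var   : Fin n → Term n
  const : ℤ → Term n
  _⊕_   : Term n → Term n → Term n
  _⊛_   : ℤ → Term n → Term n

data Formula : ℕ → Set where
  _≤'_ : ∀ {n} → Term n → Term n → Formula n
  _≐_  : ∀ {n} → Term n → Term n → Formula n
  ⊤'   : ∀ {n} → Formula n
  ⊥'   : ∀ {n} → Formula n
  ¬'_  : ∀ {n} → Formula n → Formula n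
  _∧'_ : ∀ {n} → Formula n → Formula n → Formula n
  _∨'_ : ∀ {n} → Formula n → Formula n → Formula n
  ∃'_  : ∀ {n} → Formula (suc n) → Formula n
  ∀'_  : ∀ {n} → Formula (suc n) → Formula n

Env : ℕ → Set
Env n = Fin n → ℤ

extend : ∀ {n} → ℤ → Env n → Env (suc n)
extend a ρ Fin.zero    = a
extend a ρ (Fin.suc i) = ρ i

evalT : ∀ {n} → Term n → Env n → ℤ
evalT (var i)   ρ = ρ i
evalT (const c) ρ = c
evalT (s ⊕ t)   ρ = evalT s ρ ℤ.+ evalT t ρ
evalT (c ⊛ t)   ρ = c ℤ.* evalT t ρ

⟦_⟧ : ∀ {n} → Formula n → Env n → Set
⟦ s ≤' t ⟧ ρ = evalT s ρ ℤ.≤ evalT t ρ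
⟦ s ≐ t  ⟧ ρ = evalT s ρ ≡ evalT t ρ
⟦ ⊤'     ⟧ ρ = ⊤
⟦ ⊥'     ⟧ ρ = ⊥
⟦ ¬' φ   ⟧ ρ = ⟦ φ ⟧ ρ → ⊥
⟦ φ ∧' ψ ⟧ ρ = ⟦ φ ⟧ ρ × ⟦ ψ ⟧ ρ
⟦ φ ∨' ψ ⟧ ρ = ⟦ φ ⟧ ρ ⊎ ⟦ ψ ⟧ ρ
⟦ ∃' φ   ⟧ ρ = Σ ℤ (λ a → ⟦ φ ⟧ (extend a ρ))
⟦ ∀' φ   ⟧ ρ = (a : ℤ) → ⟦ φ ⟧ (extend a ρ)

-- a subset of ℤ^m is semilinear iff it is Presburger-definable
SemilinearZ^ : (m : ℕ) → (Env m → Set) → Set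
SemilinearZ^ m A = Σ (Formula m) (λ φ → ∀ ρ → ⟦ φ ⟧ ρ ⇔ A ρ)

SemilinearZ¹ : (ℤ → Set) → Set
SemilinearZ¹ A = SemilinearZ^ 1 (λ ρ → A (ρ Fin.zero))

SemilinearZ² : (ℤ → ℤ → Set) → Set
SemilinearZ² A = SemilinearZ^ 2 (λ ρ → A (ρ Fin.zero) (ρ (Fin.suc Fin.zero)))

SemilinearZmod : (m : ℕ) → (Zk (suc m) → Set) → Set
SemilinearZmod m A = SemilinearZ¹ (λ t → A (proj (suc m) t))

-- Semilinear subsets of ℤ_k × ℤ_l, via the standard equivariant
-- decomposition into monomials:
--   ℤ   × ℤ    = ℤ²
--   ℤ   × ℤ_l ≅ l copies of ℤ,   copy c : t ↦ (t , [t + c]_l)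
--   ℤ_k × ℤ   ≅ k copies of ℤ,   copy c : t ↦ ([t + c]_k , t)
--   ℤ_k × ℤ_l ≅ gcd(k,l) copies of ℤ_lcm(k,l), copy c : [t] ↦ ([t]_k , [t + c]_l)
-- (for the last case the copy ℤ_lcm is described through its preimage in ℤ).

SemilinearPair : (k l : ℕ) → (Zk k → Zk l → Set) → Set
SemilinearPair zero zero S = SemilinearZ² S
SemilinearPair zero (suc l) S =
  (c : Fin (suc l)) → SemilinearZ¹ (λ t → S t (proj (suc l) (t ℤ.+ + Fin.toℕ c)))
SemilinearPair (suc k) zero S =
  (c : Fin (suc k)) → SemilinearZ¹ (λ t → S (proj (suc k) (t ℤ.+ + Fin.toℕ c)) t)
SemilinearPair (suc k) (suc l) S =
  (c : Fin (gcd (suc k) (suc l))) →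
    SemilinearZ¹ (λ t → S (proj (suc k) t) (proj (suc l) (t ℤ.+ + Fin.toℕ c)))

SemilinearFun : (k l : ℕ) → (Zk k → Zk l) → Set
SemilinearFun k l f = SemilinearPair k l (λ x y → f x ≡ y)

-- The canonical projection proj k : ℤ → ℤ_k is itself equivariant, so
-- every point of ℤ_k is the translate of the origin proj k 0, and an
-- equivariant f : ℤ_k → ℤ_l is determined by one value: f(proj k t) is the
-- translate of f(origin) by t.
module Submission where

open import Defs
open import Data.Nat using (ℕ)

open import Data.Nat as ℕ using (zero; suc; NonZero)
import Data.Nat.Properties as ℕP
open import Data.Nat.Divisibility using (_∣_; divides; n∣m⇒m%n≡0)
open import Data.Nat.DivMod using (m<n⇒m%n≡m)
open import Data.Integer as ℤ using (ℤ; +_; 0ℤ; _%ℕ_; _/ℕ_; -_; _-_; ∣_∣)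
import Data.Integer.Properties as ℤP
open import Data.Integer.DivMod using (n%ℕd<d; a≡a%ℕn+[a/ℕn]*n)
open import Data.Integer.Tactic.RingSolver using (solve-∀)
open import Data.Fin as Fin using (toℕ)
import Data.Fin.Properties as FinP
open import Data.Product using (_,_)
open import Data.Empty using (⊥)
open import Data.Unit using (tt)
open import Relation.Nullary using (Dec; yes; no)
open import Relation.Binary.PropositionalEquality
open import Function.Bundles using (_⇔_; mk⇔; Equivalence)

multiple-below⇒zero : ∀ {a m} .{{_ : NonZero m}} → m ∣ a → a ℕ.< m → a ≡ 0
multiple-below⇒zero {a} {m} m∣a a<m = trans (sym (m<n⇒m%n≡m a<m)) (n∣m⇒m%n≡0 a m m∣a)

-- Two decompositions r + q·m and r' + q'·m of the same integer with
-- 0 ≤ r, r' < m have the same remainder: r' - r is a multiple of m below m.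
remainder-unique : ∀ {m r r'} .{{_ : NonZero m}} (q q' : ℤ) → r ℕ.< m → r' ℕ.< m →
                   + r ℤ.+ q ℤ.* + m ≡ + r' ℤ.+ q' ℤ.* + m → r ≡ r'
remainder-unique {m} {r} {r'} q q' r<m r'<m e =
  sym (ℤP.+-injective (ℤP.i-j≡0⇒i≡j (+ r') (+ r) (ℤP.∣i∣≡0⇒i≡0 ∣d∣≡0)))
  where
  d : ℤ
  d = + r' - + r

  cancel-common : ∀ (a b c : ℤ) → a - b ≡ (a ℤ.+ c) - (b ℤ.+ c)
  cancel-common = solve-∀

  difference : ∀ (a x y z : ℤ) → (a ℤ.+ x ℤ.* z) - (a ℤ.+ y ℤ.* z) ≡ (x - y) ℤ.* z
  difference = solve-∀

  d-multiple : d ≡ (q - q') ℤ.* + m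
  d-multiple = begin
    + r' - + r                                          ≡⟨ cancel-common (+ r') (+ r) (q' ℤ.* + m) ⟩
    (+ r' ℤ.+ q' ℤ.* + m) - (+ r ℤ.+ q' ℤ.* + m)        ≡⟨ cong (_- (+ r ℤ.+ q' ℤ.* + m)) (sym e) ⟩
    (+ r ℤ.+ q ℤ.* + m) - (+ r ℤ.+ q' ℤ.* + m)          ≡⟨ difference (+ r) q q' (+ m) ⟩
    (q - q') ℤ.* + m                                    ∎
    where open ≡-Reasoning

  m∣∣d∣ : m ∣ ∣ d ∣
  m∣∣d∣ = divides ∣ q - q' ∣ (trans (cong ∣_∣ d-multiple) (ℤP.abs-* (q - q') (+ m)))

  ∣d∣<m : ∣ d ∣ ℕ.< m
  ∣d∣<m = ℕP.≤-<-trans (ℕP.≤-reflexive (cong ∣_∣ (ℤP.m-n≡m⊖n r' r)))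
            (ℕP.≤-<-trans (ℤP.∣m⊝n∣≤m⊔n r' r) (ℕP.⊔-pres-<m r'<m r<m))

  ∣d∣≡0 : ∣ d ∣ ≡ 0
  ∣d∣≡0 = multiple-below⇒zero m∣∣d∣ ∣d∣<m

%ℕ-periodic : ∀ m .{{_ : NonZero m}} (a q : ℤ) → (a ℤ.+ q ℤ.* + m) %ℕ m ≡ a %ℕ m
%ℕ-periodic m a q =
  remainder-unique (b /ℕ m) (a /ℕ m ℤ.+ q) (n%ℕd<d b m) (n%ℕd<d a m) (begin
    + (b %ℕ m) ℤ.+ (b /ℕ m) ℤ.* + m                   ≡⟨ sym (a≡a%ℕn+[a/ℕn]*n b m) ⟩
    a ℤ.+ q ℤ.* + m                                   ≡⟨ cong (ℤ._+ q ℤ.* + m) (a≡a%ℕn+[a/ℕn]*n a m) ⟩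
    (+ (a %ℕ m) ℤ.+ (a /ℕ m) ℤ.* + m) ℤ.+ q ℤ.* + m   ≡⟨ regroup (+ (a %ℕ m)) (a /ℕ m) q (+ m) ⟩
    + (a %ℕ m) ℤ.+ (a /ℕ m ℤ.+ q) ℤ.* + m             ∎)
  where
  open ≡-Reasoning
  b : ℤ
  b = a ℤ.+ q ℤ.* + m

  regroup : ∀ (r x y z : ℤ) → (r ℤ.+ x ℤ.* z) ℤ.+ y ℤ.* z ≡ r ℤ.+ (x ℤ.+ y) ℤ.* z
  regroup = solve-∀

%ℕ-reduce : ∀ m .{{_ : NonZero m}} (a c : ℤ) → (+ (a %ℕ m) ℤ.+ c) %ℕ m ≡ (a ℤ.+ c) %ℕ m
%ℕ-reduce m a c = begin
  (+ (a %ℕ m) ℤ.+ c) %ℕ m                          ≡⟨ sym (%ℕ-periodic m (+ (a %ℕ m) ℤ.+ c) (a /ℕ m)) ⟩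
  ((+ (a %ℕ m) ℤ.+ c) ℤ.+ (a /ℕ m) ℤ.* + m) %ℕ m   ≡⟨ cong (_%ℕ m) (regroup (+ (a %ℕ m)) c (a /ℕ m ℤ.* + m)) ⟩
  ((+ (a %ℕ m) ℤ.+ (a /ℕ m) ℤ.* + m) ℤ.+ c) %ℕ m   ≡⟨ cong (λ u → (u ℤ.+ c) %ℕ m) (sym (a≡a%ℕn+[a/ℕn]*n a m)) ⟩
  (a ℤ.+ c) %ℕ m                                   ∎
  where
  open ≡-Reasoning
  regroup : ∀ (r c x : ℤ) → (r ℤ.+ c) ℤ.+ x ≡ (r ℤ.+ x) ℤ.+ c
  regroup = solve-∀

proj-≡ : ∀ n (a b : ℤ) → a %ℕ suc n ≡ b %ℕ suc n → proj (suc n) a ≡ proj (suc n) b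
proj-≡ n a b e = FinP.fromℕ<-cong _ _ e _ _

proj-equivariant : ∀ k (a t : ℤ) → act k (proj k a) t ≡ proj k (a ℤ.+ t)
proj-equivariant zero    a t = refl
proj-equivariant (suc n) a t = proj-≡ n (+ toℕ (proj (suc n) a) ℤ.+ t) (a ℤ.+ t) (begin
  (+ toℕ (proj (suc n) a) ℤ.+ t) %ℕ suc n   ≡⟨ cong (λ i → (+ i ℤ.+ t) %ℕ suc n) (FinP.toℕ-fromℕ< _) ⟩
  (+ (a %ℕ suc n) ℤ.+ t) %ℕ suc n           ≡⟨ %ℕ-reduce (suc n) a t ⟩
  (a ℤ.+ t) %ℕ suc n                        ∎)
  where open ≡-Reasoning

proj-rep : ∀ k (x : Zk k) → proj k (rep k x) ≡ x
proj-rep zero    x = refl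
proj-rep (suc n) x = FinP.toℕ-injective (trans (FinP.toℕ-fromℕ< _) (m<n⇒m%n≡m (FinP.toℕ<n x)))

act-identity : ∀ k (x : Zk k) → act k x 0ℤ ≡ x
act-identity k x = trans (cong (proj k) (ℤP.+-identityʳ (rep k x))) (proj-rep k x)

act-compose : ∀ k (x : Zk k) (z w : ℤ) → act k (act k x z) w ≡ act k x (z ℤ.+ w)
act-compose k x z w =
  trans (proj-equivariant k (rep k x ℤ.+ z) w) (cong (proj k) (ℤP.+-assoc (rep k x) z w))

act-injective : ∀ k {x y : Zk k} (t : ℤ) → act k x t ≡ act k y t → x ≡ y
act-injective k {x} {y} t e = trans (sym (undo x)) (trans (cong (λ u → act k u (- t)) e) (undo y))
  where
  undo : ∀ u → act k (act k u t) (- t) ≡ u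
  undo u = begin
    act k (act k u t) (- t)   ≡⟨ act-compose k u t (- t) ⟩
    act k u (t - t)           ≡⟨ cong (act k u) (ℤP.+-inverseʳ t) ⟩
    act k u 0ℤ                ≡⟨ act-identity k u ⟩
    u                         ∎
    where open ≡-Reasoning

act-period : ∀ n (x : Zk (suc n)) → act (suc n) x (+ suc n) ≡ x
act-period n x = trans (proj-≡ n (rep (suc n) x ℤ.+ + suc n) (rep (suc n) x) (begin
  (rep (suc n) x ℤ.+ + suc n) %ℕ suc n           ≡⟨ cong (λ u → (rep (suc n) x ℤ.+ u) %ℕ suc n) (sym (ℤP.*-identityˡ (+ suc n))) ⟩
  (rep (suc n) x ℤ.+ + 1 ℤ.* + suc n) %ℕ suc n   ≡⟨ %ℕ-periodic (suc n) (rep (suc n) x) (+ 1) ⟩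
  rep (suc n) x %ℕ suc n                         ∎))
  (proj-rep (suc n) x)
  where open ≡-Reasoning

equivariant-orbit : ∀ k l (f : Zk k → Zk l) → Equivariant k l f →
                    ∀ t → f (proj k t) ≡ act l (f (proj k 0ℤ)) t
equivariant-orbit k l f eqv t = begin
  f (proj k t)               ≡⟨ cong (λ u → f (proj k u)) (sym (ℤP.+-identityˡ t)) ⟩
  f (proj k (0ℤ ℤ.+ t))      ≡⟨ cong f (sym (proj-equivariant k 0ℤ t)) ⟩
  f (act k (proj k 0ℤ) t)    ≡⟨ eqv (proj k 0ℤ) t ⟩
  act l (f (proj k 0ℤ)) t    ∎
  where open ≡-Reasoning

-- On the copy t ↦ (proj t , proj (t + c)) of ℤ inside ℤ_k × ℤ_l, the graph
-- condition of an equivariant f does not depend on t.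
graph-on-copy : ∀ k l (f : Zk k → Zk l) → Equivariant k l f → ∀ (c t : ℤ) →
                (f (proj k t) ≡ proj l (t ℤ.+ c)) ⇔ (f (proj k 0ℤ) ≡ proj l c)
graph-on-copy k l f eqv c t = mk⇔
  (λ e → act-injective l t (trans (sym (equivariant-orbit k l f eqv t)) (trans e (shift c))))
  (λ e → trans (equivariant-orbit k l f eqv t) (trans (cong (λ y → act l y t) e) (sym (shift c))))
  where
  shift : ∀ c → proj l (t ℤ.+ c) ≡ act l (proj l c) t
  shift c = trans (cong (proj l) (ℤP.+-comm t c)) (sym (proj-equivariant l c t))

-- There is no equivariant function from a finite orbit ℤ_(n+1) to ℤ:
-- translation by n+1 would have to fix f x, yet it moves every integer.
no-equivariant-finite→ℤ : ∀ n (f : Zk (suc n) → ℤ) → Equivariant (suc n) zero f → ⊥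
no-equivariant-finite→ℤ n f eqv =
  ℤP.<-irrefl (trans (ℤP.+-identityʳ y) fixed) (ℤP.+-monoʳ-< y (ℤ.+<+ (ℕ.s≤s ℕ.z≤n)))
  where
  y : ℤ
  y = f (proj (suc n) 0ℤ)
  fixed : y ≡ y ℤ.+ + suc n
  fixed = trans (cong f (sym (act-period n (proj (suc n) 0ℤ)))) (eqv (proj (suc n) 0ℤ) (+ suc n))

translation-graph-semilinear : ∀ (g : ℤ → ℤ) (c : ℤ) → (∀ t → g t ≡ t ℤ.+ c) →
                               SemilinearZ² (λ x y → g x ≡ y)
translation-graph-semilinear g c line =
  var (Fin.suc Fin.zero) ≐ (var Fin.zero ⊕ const c) ,
  λ ρ → mk⇔ (λ e → trans (line (ρ Fin.zero)) (sym e)) (λ e → trans (sym e) (line (ρ Fin.zero)))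

constant-semilinear : ∀ (A : ℤ → Set) {P : Set} → Dec P → (∀ t → A t ⇔ P) → SemilinearZ¹ A
constant-semilinear A (yes p) A⇔P =
  ⊤' , λ ρ → mk⇔ (λ _ → Equivalence.from (A⇔P (ρ Fin.zero)) p) (λ _ → tt)
constant-semilinear A (no ¬p) A⇔P =
  ⊥' , λ ρ → mk⇔ (λ ()) (λ a → ¬p (Equivalence.to (A⇔P (ρ Fin.zero)) a))

corollary1 : (k l : ℕ) (f : Zk k → Zk l) → Equivariant k l f → SemilinearFun k l f
corollary1 zero zero f eqv =
  translation-graph-semilinear f (f 0ℤ)
    (λ t → trans (equivariant-orbit zero zero f eqv t) (ℤP.+-comm (f 0ℤ) t))
corollary1 zero (suc l) f eqv c =
  constant-semilinear _ (f 0ℤ Fin.≟ proj (suc l) (+ toℕ c))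
    (graph-on-copy zero (suc l) f eqv (+ toℕ c))
corollary1 (suc k) (suc l) f eqv c =
  constant-semilinear _ (f (proj (suc k) 0ℤ) Fin.≟ proj (suc l) (+ toℕ c))
    (graph-on-copy (suc k) (suc l) f eqv (+ toℕ c))
corollary1 (suc k) zero f eqv with no-equivariant-finite→ℤ k f eqv
... | ()
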